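{- Let $\mathsf{M}$ be any lambda term. Then the density, among all lambda terms, of the terms that do not have $\mathsf{M}$ as a subterm is $0$.
   Context: Lambda terms in de Bruijn notation: $M ::= \underline{0} \mid S\,n \mid \lambda M \mid M\,M$ with de Bruijn indices $n ::= \underline{0}\mid S\,n$ (not necessarily closed). Size: $|\underline{0}|=1$, $|S\,n|=|n|+1$, $|\lambda M|=|M|+1$, $|M_1M_2|=|M_1|+|M_2|+1$. A term $N$ has $\mathsf{M}$ as a subterm if $N=\mathsf{M}$, or $N=\lambda N_1$ and $N_1$ has $\mathsf{M}$ as a subterm, or $N = N_1N_2$ and $N_1$ or $N_2$ has $\mathsf{M}$ as a subterm. The density of a set $\mathcal{A}$ of terms among all terms is $\lim_{n\to\infty}A_n/L_n$, where $A_n$ is the number of elements of $\mathcal{A}$ of size $n$ and $L_n$ the number of all lambda terms of size $n$. -}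

module Defs where

open import Data.Nat using (ℕ; zero; suc; _+_)
import Data.Nat.Properties as ℕP
open import Data.List using (List; []; _∷_; map; _++_; concatMap; zip; reverse; filter; length)
open import Data.Product using (_×_; _,_)
open import Data.Sum using (_⊎_; inj₁; inj₂)
open import Relation.Nullary using (Dec; yes; no; ¬_)
open import Relation.Nullary.Decidable using (map′)
open import Relation.Binary.PropositionalEquality using (_≡_; refl; cong; cong₂)

-- Lambda terms in de Bruijn notation.  A de Bruijn index S^i 0 is
-- represented by  ix i  (i : ℕ counts the S's).
data Term : Set where
  ix  : ℕ → Term
  lam : Term → Term
  app : Term → Term → Term

-- Size: |0| = 1, |S n| = |n| + 1, so |S^i 0| = i + 1.
size : Term → ℕ
size (ix i)    = suc i
size (lam M)   = suc (size M)
size (app M N) = suc (size M + size N)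

data HasSubterm (M : Term) : Term → Set where
  here  : HasSubterm M M
  inLam : ∀ {N} → HasSubterm M N → HasSubterm M (lam N)
  inFun : ∀ {N₁ N₂} → HasSubterm M N₁ → HasSubterm M (app N₁ N₂)
  inArg : ∀ {N₁ N₂} → HasSubterm M N₂ → HasSubterm M (app N₁ N₂)

lam-inj : ∀ {M N} → lam M ≡ lam N → M ≡ N
lam-inj refl = refl

ix-inj : ∀ {i j} → ix i ≡ ix j → i ≡ j
ix-inj refl = refl

app-inj₁ : ∀ {M M' N N'} → app M N ≡ app M' N' → M ≡ M'
app-inj₁ refl = refl

app-inj₂ : ∀ {M M' N N'} → app M N ≡ app M' N' → N ≡ N'
app-inj₂ refl = refl

_≟_ : (M N : Term) → Dec (M ≡ N)
ix i ≟ ix j with i ℕP.≟ j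
... | yes refl = yes refl
... | no ne = no (λ e → ne (ix-inj e))
ix i ≟ lam N = no (λ ())
ix i ≟ app N N₁ = no (λ ())
lam M ≟ ix j = no (λ ())
lam M ≟ lam N with M ≟ N
... | yes refl = yes refl
... | no ne = no (λ e → ne (lam-inj e))
lam M ≟ app N N₁ = no (λ ())
app M M₁ ≟ ix j = no (λ ())
app M M₁ ≟ lam N = no (λ ())
app M M₁ ≟ app N N₁ with M ≟ N | M₁ ≟ N₁
... | yes refl | yes refl = yes refl
... | no ne | _ = no (λ e → ne (app-inj₁ e))
... | yes _ | no ne = no (λ e → ne (app-inj₂ e))

hasSubterm? : (M N : Term) → Dec (HasSubterm M N)
hasSubterm? M N with M ≟ N
... | yes refl = yes here
hasSubterm? M (ix i) | no ne = no λ { here → ne refl }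
hasSubterm? M (lam N) | no ne with hasSubterm? M N
... | yes h = yes (inLam h)
... | no nh = no λ { here → ne refl ; (inLam h) → nh h }
hasSubterm? M (app N₁ N₂) | no ne with hasSubterm? M N₁ | hasSubterm? M N₂
... | yes h | _ = yes (inFun h)
... | no _ | yes h = yes (inArg h)
... | no nh₁ | no nh₂ = no λ { here → ne refl ; (inFun h) → nh₁ h ; (inArg h) → nh₂ h }

avoids? : (M N : Term) → Dec (¬ HasSubterm M N)
avoids? M N with hasSubterm? M N
... | yes h = no (λ nh → nh h)
... | no nh = yes nh

-- Enumeration of all terms by size.
-- table n = [T n , T (n-1) , … , T 0]  where T k lists all terms of size k.
private
  nextSize : ℕ → List (List Term) → List Term
  nextSize n prev =
    ix n ∷ (lamsOf prev ++ concatMap apps (zip prev (reverse prev)))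
    where
      lamsOf : List (List Term) → List Term
      lamsOf []       = []
      lamsOf (T ∷ _)  = map lam T
      apps : List Term × List Term → List Term
      apps (A , B) = concatMap (λ x → map (app x) B) A

table : ℕ → List (List Term)
table zero    = [] ∷ []
table (suc n) = nextSize n (table n) ∷ table n

termsOfSize : ℕ → List Term
termsOfSize n with table n
... | []    = []
... | T ∷ _ = T

L : ℕ → ℕ
L n = length (termsOfSize n)

A : Term → ℕ → ℕ
A M n = length (filter (avoids? M) (termsOfSize n))

-- Splitting a term
-- of size n + 1 at its root gives L (n + 1) = 1 + L n + Σₖ L (n − k) L k, and the same
-- recursion bounds A from above; moreover A ≤ L, and A s < L s for s = |M| because M does
-- not avoid itself.  Suppose q A j ≤ p L j for all large j.  Running the recursion for A
-- against the one for L, the summand k = s loses at least p L (n − s), which is a fixed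
-- fraction 1/9^(s+1) of p L (n + 1) since L (m + 1) ≤ 9 L m for m ≥ 1.  This improves the
-- ratio p/q by a constant factor x/(x+1), and iterating drives A n / L n below any 1/k.
-- The growth bound is a double counting: with C m the total of the weight shrinks over the
-- terms of size m, n L (n + 1) ≤ 3 C (n + 1) and C (n + 1) ≤ 3 n L n.
module Submission where

open import Defs
open import Data.Nat using (ℕ; zero; suc; _+_; _*_; _∸_; _^_; _≤_; _<_; z≤n; s≤s; _≤?_; >-nonZero)
open import Data.Nat.Properties hiding (_≟_)
open import Algebra.Properties.CommutativeSemigroup +-commutativeSemigroup using () renaming (interchange to +-interchange)
open import Data.Nat.Induction using (<-rec)
open import Data.Nat.Tactic.RingSolver using (solve-∀)
open import Data.List using (List; []; _∷_; map; _++_; concatMap; zip; reverse; filter; length; upTo; downFrom; applyUpTo)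
open import Data.List.Properties using (concatMap-cong; reverse-map; reverse-downFrom; map-applyUpTo; map-upTo)
open import Data.Product using (_×_; _,_; proj₁; proj₂; ∃-syntax)
open import Data.Empty using (⊥-elim)
open import Data.Sum using (_⊎_; inj₁; inj₂)
open import Relation.Nullary using (Dec; yes; no)
open import Relation.Unary using (Decidable)
open import Relation.Binary.PropositionalEquality

private variable
  X Y : Set

sumBy : (X → ℕ) → List X → ℕ
sumBy f []       = 0
sumBy f (x ∷ xs) = f x + sumBy f xs

sumBy-++ : (f : X → ℕ) (xs ys : List X) → sumBy f (xs ++ ys) ≡ sumBy f xs + sumBy f ys
sumBy-++ f []       ys = refl
sumBy-++ f (x ∷ xs) ys = trans (cong (f x +_) (sumBy-++ f xs ys)) (sym (+-assoc (f x) _ _))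

sumBy-map : (f : Y → ℕ) (g : X → Y) (xs : List X) → sumBy f (map g xs) ≡ sumBy (λ x → f (g x)) xs
sumBy-map f g []       = refl
sumBy-map f g (x ∷ xs) = cong (f (g x) +_) (sumBy-map f g xs)

sumBy-concatMap : (f : Y → ℕ) (g : X → List Y) (xs : List X) →
  sumBy f (concatMap g xs) ≡ sumBy (λ x → sumBy f (g x)) xs
sumBy-concatMap f g []       = refl
sumBy-concatMap f g (x ∷ xs) =
  trans (sumBy-++ f (g x) (concatMap g xs)) (cong (sumBy f (g x) +_) (sumBy-concatMap f g xs))

sumBy-mono : {f g : X → ℕ} → (∀ x → f x ≤ g x) → (xs : List X) → sumBy f xs ≤ sumBy g xs
sumBy-mono f≤g []       = z≤n
sumBy-mono f≤g (x ∷ xs) = +-mono-≤ (f≤g x) (sumBy-mono f≤g xs)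

sumBy-cong : {f g : X → ℕ} → (∀ x → f x ≡ g x) → (xs : List X) → sumBy f xs ≡ sumBy g xs
sumBy-cong f≡g []       = refl
sumBy-cong f≡g (x ∷ xs) = cong₂ _+_ (f≡g x) (sumBy-cong f≡g xs)

sumBy-+ : (f g : X → ℕ) (xs : List X) → sumBy (λ x → f x + g x) xs ≡ sumBy f xs + sumBy g xs
sumBy-+ f g []       = refl
sumBy-+ f g (x ∷ xs) = trans (cong (f x + g x +_) (sumBy-+ f g xs)) (+-interchange (f x) (g x) _ _)

sumBy-*ˡ : (c : ℕ) (f : X → ℕ) (xs : List X) → sumBy (λ x → c * f x) xs ≡ c * sumBy f xs
sumBy-*ˡ c f []       = sym (*-zeroʳ c)
sumBy-*ˡ c f (x ∷ xs) = trans (cong (c * f x +_) (sumBy-*ˡ c f xs)) (sym (*-distribˡ-+ c (f x) _))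

sumBy-*ʳ : (c : ℕ) (f : X → ℕ) (xs : List X) → sumBy (λ x → f x * c) xs ≡ sumBy f xs * c
sumBy-*ʳ c f xs = trans (sumBy-cong (λ x → *-comm (f x) c) xs) (trans (sumBy-*ˡ c f xs) (*-comm c _))

length-sumBy : (xs : List X) → length xs ≡ sumBy (λ _ → 1) xs
length-sumBy []       = refl
length-sumBy (x ∷ xs) = cong suc (length-sumBy xs)

𝟙 : {P : Set} → Dec P → ℕ
𝟙 (yes _) = 1
𝟙 (no _)  = 0

𝟙≤1 : {P : Set} (p : Dec P) → 𝟙 p ≤ 1
𝟙≤1 (yes _) = ≤-refl
𝟙≤1 (no _)  = z≤n

𝟙-mono : {P Q : Set} → (P → Q) → (p : Dec P) (q : Dec Q) → 𝟙 p ≤ 𝟙 q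
𝟙-mono P⇒Q (yes _) (yes _) = ≤-refl
𝟙-mono P⇒Q (yes p) (no ¬q) = ⊥-elim (¬q (P⇒Q p))
𝟙-mono P⇒Q (no _)  _       = z≤n

𝟙-mono-× : {P Q R : Set} → (P → Q × R) → (p : Dec P) (q : Dec Q) (r : Dec R) → 𝟙 p ≤ 𝟙 q * 𝟙 r
𝟙-mono-× P⇒Q×R (yes _) (yes _) (yes _) = ≤-refl
𝟙-mono-× P⇒Q×R (yes p) (no ¬q) _       = ⊥-elim (¬q (proj₁ (P⇒Q×R p)))
𝟙-mono-× P⇒Q×R (yes p) (yes _) (no ¬r) = ⊥-elim (¬r (proj₂ (P⇒Q×R p)))
𝟙-mono-× P⇒Q×R (no _)  _       _       = z≤n

length-filter-sumBy : {P : X → Set} (P? : Decidable P) (xs : List X) →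
  length (filter P? xs) ≡ sumBy (λ x → 𝟙 (P? x)) xs
length-filter-sumBy P? []       = refl
length-filter-sumBy P? (x ∷ xs) with P? x
... | yes _ = cong suc (length-filter-sumBy P? xs)
... | no _  = length-filter-sumBy P? xs

sum≤ : ℕ → (ℕ → ℕ) → ℕ
sum≤ zero    g = g 0
sum≤ (suc n) g = g 0 + sum≤ n (λ k → g (suc k))

infix 5 sum≤
syntax sum≤ n (λ k → e) = ∑[ k ≤ n ] e

sum≤-mono : ∀ n {g h : ℕ → ℕ} → (∀ k → k ≤ n → g k ≤ h k) → sum≤ n g ≤ sum≤ n h
sum≤-mono zero    g≤h = g≤h 0 z≤n
sum≤-mono (suc n) g≤h = +-mono-≤ (g≤h 0 z≤n) (sum≤-mono n (λ k k≤n → g≤h (suc k) (s≤s k≤n)))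

sum≤-cong : ∀ n {g h : ℕ → ℕ} → (∀ k → k ≤ n → g k ≡ h k) → sum≤ n g ≡ sum≤ n h
sum≤-cong zero    g≡h = g≡h 0 z≤n
sum≤-cong (suc n) g≡h = cong₂ _+_ (g≡h 0 z≤n) (sum≤-cong n (λ k k≤n → g≡h (suc k) (s≤s k≤n)))

sum≤-*ˡ : ∀ n c (g : ℕ → ℕ) → ∑[ k ≤ n ] c * g k ≡ c * sum≤ n g
sum≤-*ˡ zero    c g = refl
sum≤-*ˡ (suc n) c g =
  trans (cong (c * g 0 +_) (sum≤-*ˡ n c (λ k → g (suc k)))) (sym (*-distribˡ-+ c (g 0) _))

sum≤-+ : ∀ n (g h : ℕ → ℕ) → ∑[ k ≤ n ] (g k + h k) ≡ sum≤ n g + sum≤ n h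
sum≤-+ zero    g h = refl
sum≤-+ (suc n) g h = trans (cong (g 0 + h 0 +_) (sum≤-+ n (λ k → g (suc k)) (λ k → h (suc k))))
                          (+-interchange (g 0) (h 0) _ _)

sum≤-last : ∀ n (g : ℕ → ℕ) → sum≤ (suc n) g ≡ sum≤ n g + g (suc n)
sum≤-last zero    g = refl
sum≤-last (suc n) g = trans (cong (g 0 +_) (sum≤-last n (λ k → g (suc k)))) (sym (+-assoc (g 0) _ _))

sum≤-bonus : ∀ n {g h : ℕ → ℕ} {k} b → k ≤ n → (∀ j → j ≤ n → g j ≤ h j) → g k + b ≤ h k →
  sum≤ n g + b ≤ sum≤ n h
sum≤-bonus zero    b z≤n g≤h gk+b≤hk = gk+b≤hk
sum≤-bonus (suc n) {g} {h} {zero} b _ g≤h g0+b≤h0 = begin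
  g 0 + rest g + b   ≡⟨ move-last (g 0) _ b ⟩
  g 0 + b + rest g   ≤⟨ +-mono-≤ g0+b≤h0 (sum≤-mono n (λ j j≤n → g≤h (suc j) (s≤s j≤n))) ⟩
  h 0 + rest h       ∎
  where
  open ≤-Reasoning
  rest : (ℕ → ℕ) → ℕ
  rest f = sum≤ n (λ j → f (suc j))
  move-last : ∀ a c d → a + c + d ≡ a + d + c
  move-last = solve-∀
sum≤-bonus (suc n) {g} {h} {suc k} b (s≤s k≤n) g≤h gk+b≤hk = begin
  g 0 + sum≤ n (λ j → g (suc j)) + b   ≡⟨ +-assoc (g 0) _ b ⟩
  g 0 + (sum≤ n (λ j → g (suc j)) + b) ≤⟨ +-mono-≤ (g≤h 0 z≤n)
                                            (sum≤-bonus n b k≤n (λ j j≤n → g≤h (suc j) (s≤s j≤n)) gk+b≤hk) ⟩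
  h 0 + sum≤ n (λ j → h (suc j))       ∎
  where open ≤-Reasoning

sum≤-mono-< : ∀ n {g h : ℕ → ℕ} {k} → k ≤ n → (∀ j → j ≤ n → g j ≤ h j) → g k < h k →
  sum≤ n g < sum≤ n h
sum≤-mono-< n {g} {h} {k} k≤n g≤h gk<hk =
  subst (_≤ sum≤ n h) (+-comm (sum≤ n g) 1) (sum≤-bonus n 1 k≤n g≤h (subst (_≤ h k) (+-comm 1 (g k)) gk<hk))

-- Cauchy product of sequences

infixl 7 _⋆_
_⋆_ : (ℕ → ℕ) → (ℕ → ℕ) → ℕ → ℕ
(u ⋆ v) n = ∑[ k ≤ n ] u (n ∸ k) * v k

⋆-monoˡ : ∀ n {u u′ : ℕ → ℕ} v → (∀ j → j ≤ n → u j ≤ u′ j) → (u ⋆ v) n ≤ (u′ ⋆ v) n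
⋆-monoˡ n v u≤u′ = sum≤-mono n (λ k _ → *-monoˡ-≤ (v k) (u≤u′ (n ∸ k) (m∸n≤m n k)))

⋆-monoʳ : ∀ n u {v v′ : ℕ → ℕ} → (∀ j → j ≤ n → v j ≤ v′ j) → (u ⋆ v) n ≤ (u ⋆ v′) n
⋆-monoʳ n u v≤v′ = sum≤-mono n (λ k k≤n → *-monoʳ-≤ (u (n ∸ k)) (v≤v′ k k≤n))

⋆-distribʳ-+ : ∀ n (u u′ v : ℕ → ℕ) → ((λ j → u j + u′ j) ⋆ v) n ≡ (u ⋆ v) n + (u′ ⋆ v) n
⋆-distribʳ-+ n u u′ v =
  trans (sum≤-cong n (λ k _ → *-distribʳ-+ (v k) (u (n ∸ k)) (u′ (n ∸ k)))) (sum≤-+ n _ _)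

⋆-distribˡ-+ : ∀ n (u v v′ : ℕ → ℕ) → (u ⋆ (λ j → v j + v′ j)) n ≡ (u ⋆ v) n + (u ⋆ v′) n
⋆-distribˡ-+ n u v v′ =
  trans (sum≤-cong n (λ k _ → *-distribˡ-+ (u (n ∸ k)) (v k) (v′ k))) (sum≤-+ n _ _)

⋆-scaleˡ : ∀ n c (u v : ℕ → ℕ) → ((λ j → c * u j) ⋆ v) n ≡ c * (u ⋆ v) n
⋆-scaleˡ n c u v = trans (sum≤-cong n (λ k _ → *-assoc c (u (n ∸ k)) (v k))) (sum≤-*ˡ n c _)

⋆-scaleʳ : ∀ n c (u v : ℕ → ℕ) → (u ⋆ (λ j → c * v j)) n ≡ c * (u ⋆ v) n
⋆-scaleʳ n c u v = trans (sum≤-cong n (λ k _ → swap (u (n ∸ k)) c (v k))) (sum≤-*ˡ n c _)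
  where
  swap : ∀ a c b → a * (c * b) ≡ c * (a * b)
  swap = solve-∀

⋆-sucˡ : ∀ n (u v : ℕ → ℕ) → u 0 ≡ 0 → (u ⋆ v) (suc n) ≡ ((λ j → u (suc j)) ⋆ v) n
⋆-sucˡ n u v u0≡0 = begin
  (u ⋆ v) (suc n)                                   ≡⟨ sum≤-last n _ ⟩
  (∑[ k ≤ n ] u (suc n ∸ k) * v k) + u (n ∸ n) * v (suc n)
    ≡⟨ cong₂ _+_ (sum≤-cong n shift) (cong (_* v (suc n)) (trans (cong u (n∸n≡0 n)) u0≡0)) ⟩
  ((λ j → u (suc j)) ⋆ v) n + 0                     ≡⟨ +-identityʳ _ ⟩
  ((λ j → u (suc j)) ⋆ v) n                         ∎
  where
  open ≡-Reasoning
  shift : ∀ k → k ≤ n → u (suc n ∸ k) * v k ≡ u (suc (n ∸ k)) * v k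
  shift k k≤n = cong (λ i → u i * v k) (+-∸-assoc 1 k≤n)

⋆-sucʳ : ∀ n (u v : ℕ → ℕ) → v 0 ≡ 0 → (u ⋆ v) (suc n) ≡ (u ⋆ (λ j → v (suc j))) n
⋆-sucʳ n u v v0≡0 = cong (_+ (u ⋆ (λ j → v (suc j))) n) (trans (cong (u (suc n) *_) v0≡0) (*-zeroʳ (u (suc n))))

δ₀ : ℕ → ℕ
δ₀ zero    = 1
δ₀ (suc _) = 0

δ₁ : ℕ → ℕ
δ₁ zero    = 0
δ₁ (suc n) = δ₀ n

⋆-identityˡ : ∀ n (v : ℕ → ℕ) → (δ₀ ⋆ v) n ≡ v n
⋆-identityˡ zero    v = +-identityʳ (v 0)
⋆-identityˡ (suc n) v = ⋆-identityˡ n (λ j → v (suc j))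

⋆-identityʳ : ∀ n (u : ℕ → ℕ) → (u ⋆ δ₀) n ≡ u n
⋆-identityʳ zero    u = *-identityʳ (u 0)
⋆-identityʳ (suc n) u = trans (cong₂ _+_ (*-identityʳ (u (suc n))) (⋆-δ₀-suc n)) (+-identityʳ _)
  where
  ⋆-δ₀-suc : ∀ m → ∑[ k ≤ m ] u (m ∸ k) * 0 ≡ 0
  ⋆-δ₀-suc zero    = *-zeroʳ (u 0)
  ⋆-δ₀-suc (suc m) = cong₂ _+_ (*-zeroʳ (u (suc m))) (⋆-δ₀-suc m)

-- A copy of the private function with which Defs builds the applications of a given size.
appsOf : List Term × List Term → List Term
appsOf (Xs , Ys) = concatMap (λ X → map (app X) Ys) Xs

termsOfSize-suc : ∀ n → termsOfSize (suc n) ≡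
  ix n ∷ (map lam (termsOfSize n) ++ concatMap appsOf (zip (table n) (reverse (table n))))
termsOfSize-suc zero    = refl
termsOfSize-suc (suc n) =
  cong (λ ts → ix (suc n) ∷ (map lam (termsOfSize (suc n)) ++ ts))
       (concatMap-cong (λ { (_ , _) → refl }) (zip (table (suc n)) (reverse (table (suc n)))))

table≡map-termsOfSize : ∀ n → table n ≡ map termsOfSize (downFrom (suc n))
table≡map-termsOfSize zero    = refl
table≡map-termsOfSize (suc n) = cong (termsOfSize (suc n) ∷_) (table≡map-termsOfSize n)

sumBy-zip-downFrom-upTo : ∀ m (F : ℕ → X) (G : ℕ → Y) (H : X × Y → ℕ) →
  sumBy H (zip (map F (downFrom (suc m))) (map G (upTo (suc m)))) ≡ ∑[ k ≤ m ] H (F (m ∸ k) , G k)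
sumBy-zip-downFrom-upTo zero    F G H = +-identityʳ _
sumBy-zip-downFrom-upTo (suc m) F G H = cong (H (F (suc m) , G 0) +_) (begin
  sumBy H (zip (map F (downFrom (suc m))) (map G (applyUpTo suc (suc m))))
    ≡⟨ cong (λ ys → sumBy H (zip (map F (downFrom (suc m))) ys)) map-G-suc ⟩
  sumBy H (zip (map F (downFrom (suc m))) (map (λ k → G (suc k)) (upTo (suc m))))
    ≡⟨ sumBy-zip-downFrom-upTo m F (λ k → G (suc k)) H ⟩
  ∑[ k ≤ m ] H (F (m ∸ k) , G (suc k)) ∎)
  where
  open ≡-Reasoning
  map-G-suc : map G (applyUpTo suc (suc m)) ≡ map (λ k → G (suc k)) (upTo (suc m))
  map-G-suc = trans (map-applyUpTo suc G (suc m)) (sym (map-upTo (λ k → G (suc k)) (suc m)))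

sumOver : (Term → ℕ) → ℕ → ℕ
sumOver f n = sumBy f (termsOfSize n)

L-sumOver : ∀ n → L n ≡ sumOver (λ _ → 1) n
L-sumOver n = length-sumBy (termsOfSize n)

sumOver₂ : (Term → Term → ℕ) → ℕ → ℕ → ℕ
sumOver₂ g a b = sumOver (λ X → sumOver (g X) b) a

lamSum appSum : (Term → ℕ) → ℕ → ℕ
lamSum f n = sumOver (λ X → f (lam X)) n
appSum f n = ∑[ k ≤ n ] sumOver₂ (λ X Y → f (app X Y)) (n ∸ k) k

sumOver-suc : ∀ f n → sumOver f (suc n) ≡ f (ix n) + (lamSum f n + appSum f n)
sumOver-suc f n = begin
  sumBy f (termsOfSize (suc n))
    ≡⟨ cong (sumBy f) (termsOfSize-suc n) ⟩
  f (ix n) + sumBy f (map lam (termsOfSize n) ++ concatMap appsOf pairs)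
    ≡⟨ cong (f (ix n) +_) (sumBy-++ f (map lam (termsOfSize n)) (concatMap appsOf pairs)) ⟩
  f (ix n) + (sumBy f (map lam (termsOfSize n)) + sumBy f (concatMap appsOf pairs))
    ≡⟨ cong (λ s → f (ix n) + (s + sumBy f (concatMap appsOf pairs))) (sumBy-map f lam (termsOfSize n)) ⟩
  f (ix n) + (lamSum f n + sumBy f (concatMap appsOf pairs))
    ≡⟨ cong (λ s → f (ix n) + (lamSum f n + s)) (trans (sumBy-concatMap f appsOf pairs) pairSum) ⟩
  f (ix n) + (lamSum f n + appSum f n) ∎
  where
  open ≡-Reasoning
  pairs = zip (table n) (reverse (table n))
  H : List Term × List Term → ℕ
  H (Xs , Ys) = sumBy (λ X → sumBy (λ Y → f (app X Y)) Ys) Xs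
  sumBy-appsOf : ∀ p → sumBy f (appsOf p) ≡ H p
  sumBy-appsOf (Xs , Ys) = trans (sumBy-concatMap f (λ X → map (app X) Ys) Xs)
                                 (sumBy-cong (λ X → sumBy-map f (app X) Ys) Xs)
  pairSum : sumBy (λ p → sumBy f (appsOf p)) pairs ≡ appSum f n
  pairSum rewrite sumBy-cong sumBy-appsOf pairs | table≡map-termsOfSize n
                | sym (reverse-map termsOfSize (downFrom (suc n))) | reverse-downFrom (suc n)
    = sumBy-zip-downFrom-upTo n termsOfSize termsOfSize H

sumOver-mono : ∀ n {f g : Term → ℕ} → (∀ U → f U ≤ g U) → sumOver f n ≤ sumOver g n
sumOver-mono n f≤g = sumBy-mono f≤g (termsOfSize n)

sumOver₂-mono : ∀ a b {g h : Term → Term → ℕ} → (∀ X Y → g X Y ≤ h X Y) → sumOver₂ g a b ≤ sumOver₂ h a b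
sumOver₂-mono a b g≤h = sumOver-mono a (λ X → sumOver-mono b (g≤h X))

sumOver₂-* : ∀ a b (u v : Term → ℕ) → sumOver₂ (λ X Y → u X * v Y) a b ≡ sumOver u a * sumOver v b
sumOver₂-* a b u v =
  trans (sumBy-cong (λ X → sumBy-*ˡ (u X) v (termsOfSize b)) (termsOfSize a)) (sumBy-*ʳ _ u (termsOfSize a))

sumOver-const : ∀ c n → sumOver (λ _ → c) n ≡ c * L n
sumOver-const c n = trans (sumBy-cong (λ _ → sym (*-identityʳ c)) (termsOfSize n))
  (trans (sumBy-*ˡ c (λ _ → 1) (termsOfSize n)) (cong (c *_) (sym (L-sumOver n))))

sumOver-mono-sized : ∀ n {f g : Term → ℕ} → (∀ U → size U ≡ n → f U ≤ g U) → sumOver f n ≤ sumOver g n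
sumOver-mono-sized = <-rec P step
  where
  P : ℕ → Set
  P n = ∀ {f g : Term → ℕ} → (∀ U → size U ≡ n → f U ≤ g U) → sumOver f n ≤ sumOver g n
  step : ∀ n → (∀ {m} → m < n → P m) → P n
  step zero    _  _ = z≤n
  step (suc n) ih {f} {g} f≤g = subst₂ _≤_ (sym (sumOver-suc f n)) (sym (sumOver-suc g n))
    (+-mono-≤ (f≤g (ix n) refl) (+-mono-≤ (ih ≤-refl (λ X e → f≤g (lam X) (cong suc e)))
                                          (sum≤-mono n app-terms)))
    where
    app-terms : ∀ k → k ≤ n →
      sumOver₂ (λ X Y → f (app X Y)) (n ∸ k) k ≤ sumOver₂ (λ X Y → g (app X Y)) (n ∸ k) k
    app-terms k k≤n = ih (s≤s (m∸n≤m n k)) λ X eX → ih (s≤s k≤n) λ Y eY →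
      f≤g (app X Y) (cong suc (trans (cong₂ _+_ eX eY) (m∸n+n≡m k≤n)))

appSum-mono : ∀ n {f g : Term → ℕ} → (∀ U → f U ≤ g U) → appSum f n ≤ appSum g n
appSum-mono n f≤g = sum≤-mono n (λ k _ → sumOver₂-mono (n ∸ k) k (λ X Y → f≤g (app X Y)))

sumOver-suc-< : ∀ n {f g : Term → ℕ} →
  f (ix n) + (lamSum f n + appSum f n) < g (ix n) + (lamSum g n + appSum g n) → sumOver f (suc n) < sumOver g (suc n)
sumOver-suc-< n {f} {g} = subst₂ _<_ (sym (sumOver-suc f n)) (sym (sumOver-suc g n))

sumOver-<-at : ∀ W {f g : Term → ℕ} → (∀ U → f U ≤ g U) → f W < g W → sumOver f (size W) < sumOver g (size W)
sumOver-<-at (ix i) f≤g fW<gW = sumOver-suc-< i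
  (+-mono-<-≤ fW<gW (+-mono-≤ (sumOver-mono i (λ X → f≤g (lam X))) (appSum-mono i f≤g)))
sumOver-<-at (lam X) f≤g fW<gW = sumOver-suc-< (size X)
  (+-mono-≤-< (f≤g _) (+-mono-<-≤ (sumOver-<-at X (λ U → f≤g (lam U)) fW<gW) (appSum-mono (size X) f≤g)))
sumOver-<-at (app X Y) {f} {g} f≤g fW<gW = sumOver-suc-< n
  (+-mono-≤-< (f≤g _) (+-mono-≤-< (sumOver-mono n (λ U → f≤g (lam U)))
    (sum≤-mono-< n (m≤n+m (size Y) (size X)) (λ k _ → sumOver₂-mono (n ∸ k) k (λ U V → f≤g (app U V))) at-Y)))
  where
  n = size X + size Y
  at-Y : sumOver₂ (λ U V → f (app U V)) (n ∸ size Y) (size Y) < sumOver₂ (λ U V → g (app U V)) (n ∸ size Y) (size Y)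
  at-Y rewrite m+n∸n≡m (size X) (size Y) =
    sumOver-<-at X (λ U → sumOver-mono (size Y) (λ V → f≤g (app U V))) (sumOver-<-at Y (λ V → f≤g (app X V)) fW<gW)

sumOver-+ : ∀ n (f g : Term → ℕ) → sumOver (λ U → f U + g U) n ≡ sumOver f n + sumOver g n
sumOver-+ n f g = sumBy-+ f g (termsOfSize n)

sumOver₂-sep : ∀ a b (u v : Term → ℕ) → sumOver₂ (λ X Y → u X + v Y) a b ≡ sumOver u a * L b + L a * sumOver v b
sumOver₂-sep a b u v = begin
  sumOver₂ (λ X Y → u X + v Y) a b
    ≡⟨ sumBy-cong (λ X → sumBy-+ (λ _ → u X) v (termsOfSize b)) (termsOfSize a) ⟩
  sumOver (λ X → sumOver (λ _ → u X) b + sumOver v b) a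
    ≡⟨ sumBy-+ _ _ (termsOfSize a) ⟩
  sumOver (λ X → sumOver (λ _ → u X) b) a + sumOver (λ _ → sumOver v b) a
    ≡⟨ cong₂ _+_ (trans (sumBy-cong (λ X → sumOver-const (u X) b) (termsOfSize a)) (sumBy-*ʳ (L b) u (termsOfSize a)))
                 (trans (sumOver-const (sumOver v b) a) (*-comm (sumOver v b) (L a))) ⟩
  sumOver u a * L b + L a * sumOver v b ∎
  where open ≡-Reasoning

appSum-sep : ∀ n (f u v : Term → ℕ) → (∀ X Y → f (app X Y) ≡ u X + v Y) →
  appSum f n ≡ (sumOver u ⋆ L) n + (L ⋆ sumOver v) n
appSum-sep n f u v f-app = trans (sum≤-cong n pairs) (sum≤-+ n _ _)
  where
  sumOver-cong-app : ∀ a b → sumOver₂ (λ X Y → f (app X Y)) a b ≡ sumOver₂ (λ X Y → u X + v Y) a b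
  sumOver-cong-app a b = sumBy-cong (λ X → sumBy-cong (f-app X) (termsOfSize b)) (termsOfSize a)
  pairs : ∀ k → k ≤ n →
    sumOver₂ (λ X Y → f (app X Y)) (n ∸ k) k ≡ sumOver u (n ∸ k) * L k + L (n ∸ k) * sumOver v k
  pairs k _ = trans (sumOver-cong-app (n ∸ k) k) (sumOver₂-sep (n ∸ k) k u v)

-- Counting all terms and the terms avoiding M

L-suc : ∀ n → L (suc n) ≡ suc (L n + (L ⋆ L) n)
L-suc n = begin
  L (suc n)                                       ≡⟨ L-sumOver (suc n) ⟩
  sumOver (λ _ → 1) (suc n)                       ≡⟨ sumOver-suc (λ _ → 1) n ⟩
  suc (lamSum (λ _ → 1) n + appSum (λ _ → 1) n)   ≡⟨ cong suc (cong₂ _+_ (sym (L-sumOver n)) (sum≤-cong n pairs)) ⟩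
  suc (L n + (L ⋆ L) n)                           ∎
  where
  open ≡-Reasoning
  pairs : ∀ k → k ≤ n → sumOver₂ (λ _ _ → 1) (n ∸ k) k ≡ L (n ∸ k) * L k
  pairs k _ = trans (sumOver₂-* (n ∸ k) k (λ _ → 1) (λ _ → 1)) (sym (cong₂ _*_ (L-sumOver (n ∸ k)) (L-sumOver k)))

χ : Term → Term → ℕ
χ M U = 𝟙 (avoids? M U)

χ-lam : ∀ M X → χ M (lam X) ≤ χ M X
χ-lam M X = 𝟙-mono (λ ¬h h → ¬h (inLam h)) (avoids? M (lam X)) (avoids? M X)

χ-app : ∀ M X Y → χ M (app X Y) ≤ χ M X * χ M Y
χ-app M X Y = 𝟙-mono-× (λ ¬h → (λ h → ¬h (inFun h)) , (λ h → ¬h (inArg h)))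
                        (avoids? M (app X Y)) (avoids? M X) (avoids? M Y)

χ-self : ∀ M → χ M M < 1
χ-self M with avoids? M M
... | yes ¬h = ⊥-elim (¬h here)
... | no _   = s≤s z≤n

A-sumOver : ∀ M n → A M n ≡ sumOver (χ M) n
A-sumOver M n = length-filter-sumBy (avoids? M) (termsOfSize n)

A≤L : ∀ M n → A M n ≤ L n
A≤L M n = subst₂ _≤_ (sym (A-sumOver M n)) (sym (L-sumOver n)) (sumOver-mono n (λ U → 𝟙≤1 (avoids? M U)))

A<L : ∀ M → A M (size M) < L (size M)
A<L M = subst₂ _<_ (sym (A-sumOver M (size M))) (sym (L-sumOver (size M)))
  (sumOver-<-at M (λ U → 𝟙≤1 (avoids? M U)) (χ-self M))

A-suc : ∀ M n → A M (suc n) ≤ suc (A M n + (A M ⋆ A M) n)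
A-suc M n = begin
  A M (suc n)                                       ≡⟨ A-sumOver M (suc n) ⟩
  sumOver (χ M) (suc n)                             ≡⟨ sumOver-suc (χ M) n ⟩
  χ M (ix n) + (lamSum (χ M) n + appSum (χ M) n)    ≤⟨ +-mono-≤ (𝟙≤1 (avoids? M (ix n)))
                                                         (+-mono-≤ (sumOver-mono n (χ-lam M)) (sum≤-mono n pairs)) ⟩
  suc (sumOver (χ M) n + (A M ⋆ A M) n)             ≡⟨ cong (λ a → suc (a + (A M ⋆ A M) n)) (sym (A-sumOver M n)) ⟩
  suc (A M n + (A M ⋆ A M) n)                       ∎
  where
  open ≤-Reasoning
  pairs : ∀ k → k ≤ n → sumOver₂ (λ X Y → χ M (app X Y)) (n ∸ k) k ≤ A M (n ∸ k) * A M k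
  pairs k _ = ≤-trans (sumOver₂-mono (n ∸ k) k (χ-app M))
    (≤-reflexive (trans (sumOver₂-* (n ∸ k) k (χ M) (χ M)) (sym (cong₂ _*_ (A-sumOver M (n ∸ k)) (A-sumOver M k)))))

-- Growth ratio of L

isIx0 : Term → ℕ
isIx0 (ix zero) = 1
isIx0 _         = 0

isIx0≤1 : ∀ U → isIx0 U ≤ 1
isIx0≤1 (ix zero)    = ≤-refl
isIx0≤1 (ix (suc _)) = z≤n
isIx0≤1 (lam _)      = z≤n
isIx0≤1 (app _ _)    = z≤n

shrinks : Term → ℕ
shrinks (ix i)    = i
shrinks (lam X)   = suc (shrinks X)
shrinks (app X Y) = (shrinks X + isIx0 X) + (shrinks Y + isIx0 Y)

size<3*shrinks+2*isIx0 : ∀ U → suc (size U) ≤ 3 * shrinks U + 2 * isIx0 U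
size<3*shrinks+2*isIx0 (ix zero)    = ≤-refl
size<3*shrinks+2*isIx0 (ix (suc i)) = ≤-trans (m≤m+n _ (i + i)) (≤-reflexive (arith i))
  where
  arith : ∀ i → suc (suc (suc i)) + (i + i) ≡ 3 * suc i + 2 * 0
  arith = solve-∀
size<3*shrinks+2*isIx0 (lam X) = begin
  suc (suc (size X))                   ≤⟨ s≤s (size<3*shrinks+2*isIx0 X) ⟩
  suc (3 * shrinks X + 2 * isIx0 X)    ≤⟨ s≤s (+-monoʳ-≤ (3 * shrinks X) (*-monoʳ-≤ 2 (isIx0≤1 X))) ⟩
  suc (3 * shrinks X + 2 * 1)          ≡⟨ arith (shrinks X) ⟩
  3 * suc (shrinks X) + 2 * 0          ∎
  where
  open ≤-Reasoning
  arith : ∀ s → suc (3 * s + 2 * 1) ≡ 3 * suc s + 2 * 0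
  arith = solve-∀
size<3*shrinks+2*isIx0 (app X Y) = begin
  suc (suc (size X + size Y))
    ≡⟨ cong suc (sym (+-suc (size X) (size Y))) ⟩
  suc (size X) + suc (size Y)
    ≤⟨ +-mono-≤ (size<3*shrinks+2*isIx0 X) (size<3*shrinks+2*isIx0 Y) ⟩
  3 * shrinks X + 2 * isIx0 X + (3 * shrinks Y + 2 * isIx0 Y)
    ≤⟨ +-mono-≤ (+-monoʳ-≤ (3 * shrinks X) (2*≤3* (isIx0 X))) (+-monoʳ-≤ (3 * shrinks Y) (2*≤3* (isIx0 Y))) ⟩
  3 * shrinks X + 3 * isIx0 X + (3 * shrinks Y + 3 * isIx0 Y)
    ≡⟨ arith (shrinks X) (isIx0 X) (shrinks Y) (isIx0 Y) ⟩
  3 * shrinks (app X Y) + 2 * isIx0 (app X Y) ∎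
  where
  open ≤-Reasoning
  2*≤3* : ∀ w → 2 * w ≤ 3 * w
  2*≤3* w = *-monoˡ-≤ w {2} {3} (s≤s (s≤s z≤n))
  arith : ∀ s z s′ z′ → 3 * s + 3 * z + (3 * s′ + 3 * z′) ≡ 3 * (s + z + (s′ + z′)) + 2 * 0
  arith = solve-∀

size≤1+3*shrinks : ∀ U → size U ≤ suc (3 * shrinks U)
size≤1+3*shrinks U = ≤-pred (begin
  suc (size U)               ≤⟨ size<3*shrinks+2*isIx0 U ⟩
  3 * shrinks U + 2 * isIx0 U ≤⟨ +-monoʳ-≤ (3 * shrinks U) (*-monoʳ-≤ 2 (isIx0≤1 U)) ⟩
  3 * shrinks U + 2          ≡⟨ +-comm (3 * shrinks U) 2 ⟩
  suc (suc (3 * shrinks U))  ∎)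
  where open ≤-Reasoning

C Z C⁺ σ : ℕ → ℕ
C = sumOver shrinks
Z = sumOver isIx0
C⁺ j = C j + Z j
σ = sumOver size

Z≤δ₁ : ∀ n → Z n ≤ δ₁ n
Z≤δ₁ n = ≤-trans (sumOver-mono-sized n only-ix0) (≤-trans (≤-reflexive (sumOver-const (δ₁ n) n)) (δ₁*L≤δ₁ n))
  where
  only-ix0 : ∀ U → size U ≡ n → isIx0 U ≤ δ₁ n
  only-ix0 (ix zero)    refl = ≤-refl
  only-ix0 (ix (suc _)) _    = z≤n
  only-ix0 (lam _)      _    = z≤n
  only-ix0 (app _ _)    _    = z≤n
  δ₁*L≤δ₁ : ∀ n → δ₁ n * L n ≤ δ₁ n
  δ₁*L≤δ₁ zero          = z≤n
  δ₁*L≤δ₁ (suc zero)    = ≤-refl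
  δ₁*L≤δ₁ (suc (suc _)) = z≤n

σ≤n*L : ∀ n → σ n ≤ n * L n
σ≤n*L n = ≤-trans (sumOver-mono-sized n (λ U e → ≤-reflexive e)) (≤-reflexive (sumOver-const n n))

sumOver-1+ : ∀ n (f : Term → ℕ) → sumOver (λ U → suc (f U)) n ≡ L n + sumOver f n
sumOver-1+ n f = trans (sumOver-+ n (λ _ → 1) f) (cong (_+ sumOver f n) (sym (L-sumOver n)))

C-suc : ∀ n → C (suc n) ≡ n + ((L n + C n) + ((C⁺ ⋆ L) n + (L ⋆ C⁺) n))
C-suc n = trans (sumOver-suc shrinks n) (cong (n +_) (cong₂ _+_ (sumOver-1+ n shrinks) app-part))
  where
  app-part : appSum shrinks n ≡ (C⁺ ⋆ L) n + (L ⋆ C⁺) n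
  app-part = trans (appSum-sep n shrinks (λ X → shrinks X + isIx0 X) (λ Y → shrinks Y + isIx0 Y) (λ _ _ → refl))
    (cong₂ _+_ (sum≤-cong n (λ k _ → cong (_* L k) (sumOver-+ (n ∸ k) shrinks isIx0)))
               (sum≤-cong n (λ k _ → cong (L (n ∸ k) *_) (sumOver-+ k shrinks isIx0))))

σ-suc : ∀ n → σ (suc n) ≡ suc n + ((L n + σ n) + ((L ⋆ L) n + (σ ⋆ L) n + (L ⋆ σ) n))
σ-suc n = trans (sumOver-suc size n) (cong (suc n +_) (cong₂ _+_ (sumOver-1+ n size) app-part))
  where
  app-part : appSum size n ≡ (L ⋆ L) n + (σ ⋆ L) n + (L ⋆ σ) n
  app-part = trans (appSum-sep n size (λ X → suc (size X)) size (λ _ _ → refl))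
    (cong (_+ (L ⋆ σ) n) (trans (sum≤-cong n (λ k _ → cong (_* L k) (sumOver-1+ (n ∸ k) size)))
                                (⋆-distribʳ-+ n L σ L)))

module _ (m : ℕ) (ih : ∀ j → j ≤ m → C (suc j) ≤ 3 * σ j) where

  C⁺⋆L-bound : (C⁺ ⋆ L) (suc m) ≤ 3 * (σ ⋆ L) m + L m
  C⁺⋆L-bound = begin
    (C⁺ ⋆ L) (suc m)                            ≡⟨ ⋆-distribʳ-+ (suc m) C Z L ⟩
    (C ⋆ L) (suc m) + (Z ⋆ L) (suc m)           ≡⟨ cong (_+ (Z ⋆ L) (suc m)) (⋆-sucˡ m C L refl) ⟩
    ((λ j → C (suc j)) ⋆ L) m + (Z ⋆ L) (suc m) ≤⟨ +-mono-≤ (⋆-monoˡ m L ih)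
                                                             (⋆-monoˡ (suc m) L (λ j _ → Z≤δ₁ j)) ⟩
    ((λ j → 3 * σ j) ⋆ L) m + (δ₁ ⋆ L) (suc m)  ≡⟨ cong₂ _+_ (⋆-scaleˡ m 3 σ L)
                                                             (trans (⋆-sucˡ m δ₁ L refl) (⋆-identityˡ m L)) ⟩
    3 * (σ ⋆ L) m + L m                         ∎
    where open ≤-Reasoning

  L⋆C⁺-bound : (L ⋆ C⁺) (suc m) ≤ 3 * (L ⋆ σ) m + L m
  L⋆C⁺-bound = begin
    (L ⋆ C⁺) (suc m)                            ≡⟨ ⋆-distribˡ-+ (suc m) L C Z ⟩
    (L ⋆ C) (suc m) + (L ⋆ Z) (suc m)           ≡⟨ cong (_+ (L ⋆ Z) (suc m)) (⋆-sucʳ m L C refl) ⟩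
    (L ⋆ (λ j → C (suc j))) m + (L ⋆ Z) (suc m) ≤⟨ +-mono-≤ (⋆-monoʳ m L ih)
                                                             (⋆-monoʳ (suc m) L (λ j _ → Z≤δ₁ j)) ⟩
    (L ⋆ (λ j → 3 * σ j)) m + (L ⋆ δ₁) (suc m)  ≡⟨ cong₂ _+_ (⋆-scaleʳ m 3 L σ)
                                                             (trans (⋆-sucʳ m L δ₁ refl) (⋆-identityʳ m L)) ⟩
    3 * (L ⋆ σ) m + L m                         ∎
    where open ≤-Reasoning

  C-step : C (suc (suc m)) ≤ 3 * σ (suc m)
  C-step = begin
    C (suc (suc m))
      ≡⟨ C-suc (suc m) ⟩
    suc m + ((L (suc m) + C (suc m)) + ((C⁺ ⋆ L) (suc m) + (L ⋆ C⁺) (suc m)))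
      ≤⟨ +-monoʳ-≤ (suc m) (+-mono-≤ (+-mono-≤ (≤-reflexive (L-suc m)) (ih m ≤-refl))
                                     (+-mono-≤ C⁺⋆L-bound L⋆C⁺-bound)) ⟩
    suc m + ((suc (L m + (L ⋆ L) m) + 3 * σ m) + ((3 * (σ ⋆ L) m + L m) + (3 * (L ⋆ σ) m + L m)))
      ≤⟨ ≤-trans (m≤m+n _ (m + m + 1 + ((L ⋆ L) m + (L ⋆ L) m)))
                 (≤-reflexive (arith m (L m) (σ m) ((L ⋆ L) m) ((σ ⋆ L) m) ((L ⋆ σ) m))) ⟩
    3 * (suc m + ((L m + σ m) + ((L ⋆ L) m + (σ ⋆ L) m + (L ⋆ σ) m)))
      ≡⟨ cong (3 *_) (sym (σ-suc m)) ⟩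
    3 * σ (suc m) ∎
    where
    open ≤-Reasoning
    arith : ∀ m l s t a b →
      suc m + ((suc (l + t) + 3 * s) + ((3 * a + l) + (3 * b + l))) + (m + m + 1 + (t + t))
        ≡ 3 * (suc m + ((l + s) + (t + a + b)))
    arith = solve-∀

C[1+n]≤3*σ : ∀ m → C (suc m) ≤ 3 * σ m
C[1+n]≤3*σ = <-rec _ step
  where
  step : ∀ m → (∀ {j} → j < m → C (suc j) ≤ 3 * σ j) → C (suc m) ≤ 3 * σ m
  step zero    _  = z≤n
  step (suc m) ih = C-step m (λ j j≤m → ih (s≤s j≤m))

n*L[1+n]≤3*C[1+n] : ∀ n → n * L (suc n) ≤ 3 * C (suc n)
n*L[1+n]≤3*C[1+n] n = +-cancelˡ-≤ (L (suc n)) _ _ (begin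
  suc n * L (suc n)                                 ≡⟨ sumOver-const (suc n) (suc n) ⟨
  sumOver (λ _ → suc n) (suc n)                     ≤⟨ sumOver-mono-sized (suc n) size≤ ⟩
  sumOver (λ U → suc (3 * shrinks U)) (suc n)       ≡⟨ sumOver-1+ (suc n) (λ U → 3 * shrinks U) ⟩
  L (suc n) + sumOver (λ U → 3 * shrinks U) (suc n) ≡⟨ cong (L (suc n) +_) (sumBy-*ˡ 3 shrinks (termsOfSize (suc n))) ⟩
  L (suc n) + 3 * C (suc n)                         ∎)
  where
  open ≤-Reasoning
  size≤ : ∀ U → size U ≡ suc n → suc n ≤ suc (3 * shrinks U)
  size≤ U e = subst (_≤ suc (3 * shrinks U)) e (size≤1+3*shrinks U)

L-ratio : ∀ n → 1 ≤ n → L (suc n) ≤ 9 * L n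
L-ratio n 1≤n = *-cancelˡ-≤ n {{>-nonZero 1≤n}} (begin
  n * L (suc n)       ≤⟨ n*L[1+n]≤3*C[1+n] n ⟩
  3 * C (suc n)       ≤⟨ *-monoʳ-≤ 3 (≤-trans (C[1+n]≤3*σ n) (*-monoʳ-≤ 3 (σ≤n*L n))) ⟩
  3 * (3 * (n * L n)) ≡⟨ arith n (L n) ⟩
  n * (9 * L n)       ∎)
  where
  open ≤-Reasoning
  arith : ∀ n l → 3 * (3 * (n * l)) ≡ n * (9 * l)
  arith = solve-∀

-- An abstract density argument

bernoulli : ∀ x t → x ^ t * (x + t) ≤ x * suc x ^ t
bernoulli x zero = ≤-reflexive (arith x)
  where
  arith : ∀ x → 1 * (x + 0) ≡ x * 1
  arith = solve-∀
bernoulli x (suc t) = begin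
  x ^ suc t * (x + suc t)                   ≡⟨ arith₁ (x ^ t) x t ⟩
  x * (x ^ t * (x + t)) + x ^ t * x         ≤⟨ +-monoʳ-≤ (x * (x ^ t * (x + t))) (*-monoʳ-≤ (x ^ t) (m≤m+n x t)) ⟩
  x * (x ^ t * (x + t)) + x ^ t * (x + t)   ≡⟨ arith₂ x (x ^ t * (x + t)) ⟩
  suc x * (x ^ t * (x + t))                 ≤⟨ *-monoʳ-≤ (suc x) (bernoulli x t) ⟩
  suc x * (x * suc x ^ t)                   ≡⟨ arith₃ x (suc x ^ t) ⟩
  x * suc x ^ suc t                         ∎
  where
  open ≤-Reasoning
  arith₁ : ∀ y x t → x * y * (x + suc t) ≡ x * (y * (x + t)) + y * x
  arith₁ = solve-∀
  arith₂ : ∀ x w → x * w + w ≡ suc x * w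
  arith₂ = solve-∀
  arith₃ : ∀ x w → suc x * (x * w) ≡ x * (suc x * w)
  arith₃ = solve-∀

k*x^kx<[1+x]^kx : ∀ k x → 1 ≤ x → k * x ^ (k * x) < suc x ^ (k * x)
k*x^kx<[1+x]^kx k x 1≤x = begin-strict
  k * P         <⟨ +-monoˡ-≤ (k * P) (m^n>0 x (k * x)) ⟩
  P + k * P     ≡⟨ trans (cong (P +_) (*-comm k P)) (sym (*-suc P k)) ⟩
  P * suc k     ≤⟨ *-cancelˡ-≤ x (≤-trans (≤-reflexive (arith P x k)) (bernoulli x (k * x))) ⟩
  suc x ^ (k * x) ∎
  where
  instance _ = >-nonZero 1≤x
  open ≤-Reasoning
  P = x ^ (k * x)
  arith : ∀ P x k → x * (P * suc k) ≡ P * (x + k * x)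
  arith = solve-∀

ratio-improve : ∀ {p q A Lₙ L′} D → 1 ≤ p → 2 * q ≤ L′ → Lₙ ≤ D * L′ → q * A + p * L′ ≤ q + p * Lₙ →
  suc (suc (2 * D)) * q * A ≤ suc (2 * D) * p * Lₙ
ratio-improve {p} {q} {A} {Lₙ} {L′} D 1≤p 2q≤L′ Lₙ≤DL′ gap =
  subst₂ _≤_ (sym (*-assoc R q A)) (sym (*-assoc x p Lₙ)) (+-cancelʳ-≤ W (R * (q * A)) (x * (p * Lₙ)) (begin
    R * (q * A) + W             ≤⟨ +-monoʳ-≤ (R * (q * A)) absorb ⟩
    R * (q * A) + R * (p * L′)  ≡⟨ *-distribˡ-+ R (q * A) (p * L′) ⟨
    R * (q * A + p * L′)        ≤⟨ *-monoʳ-≤ R gap ⟩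
    R * (q + p * Lₙ)            ≡⟨ arith₁ D q (p * Lₙ) ⟩
    x * (p * Lₙ) + W            ∎))
  where
  open ≤-Reasoning
  x = suc (2 * D)
  R = suc x
  W = R * q + p * Lₙ
  absorb : W ≤ R * (p * L′)
  absorb = begin
    R * q + p * Lₙ                     ≡⟨ cong (_+ p * Lₙ) (arith₂ D q) ⟩
    suc D * (2 * q) + p * Lₙ           ≤⟨ +-mono-≤ (*-monoʳ-≤ (suc D) 2q≤pL′) (*-monoʳ-≤ p Lₙ≤DL′) ⟩
    suc D * (p * L′) + p * (D * L′)    ≤⟨ m≤m+n _ (p * L′) ⟩
    suc D * (p * L′) + p * (D * L′) + p * L′ ≡⟨ arith₃ D p L′ ⟩
    R * (p * L′)                       ∎
    where
    2q≤pL′ : 2 * q ≤ p * L′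
    2q≤pL′ = ≤-trans 2q≤L′ (≤-trans (≤-reflexive (sym (*-identityˡ L′))) (*-monoˡ-≤ L′ 1≤p))
    arith₂ : ∀ D q → suc (suc (2 * D)) * q ≡ suc D * (2 * q)
    arith₂ = solve-∀
    arith₃ : ∀ D p L → suc D * (p * L) + p * (D * L) + p * L ≡ suc (suc (2 * D)) * (p * L)
    arith₃ = solve-∀
  arith₁ : ∀ D q w → suc (suc (2 * D)) * (q + w) ≡ suc (2 * D) * w + (suc (suc (2 * D)) * q + w)
  arith₁ = solve-∀

module Density (l a : ℕ → ℕ) (c s : ℕ)
  (l-suc : ∀ n → suc (l n + (l ⋆ l) n) ≤ l (suc n))
  (a-suc : ∀ n → a (suc n) ≤ suc (a n + (a ⋆ a) n))
  (a≤l : ∀ n → a n ≤ l n)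
  (a<l : a s < l s)
  (l-ratio : ∀ n → 1 ≤ n → l (suc n) ≤ c * l n)
  where

  n≤l : ∀ n → n ≤ l n
  n≤l zero    = z≤n
  n≤l (suc n) = ≤-trans (s≤s (≤-trans (n≤l n) (m≤m+n _ _))) (l-suc n)

  l-ratio-iter : ∀ d j → 1 ≤ j → l (d + j) ≤ c ^ d * l j
  l-ratio-iter zero    j _   = ≤-reflexive (sym (*-identityˡ (l j)))
  l-ratio-iter (suc d) j 1≤j = begin
    l (suc d + j)         ≤⟨ l-ratio (d + j) (≤-trans 1≤j (m≤n+m j d)) ⟩
    c * l (d + j)         ≤⟨ *-monoʳ-≤ c (l-ratio-iter d j 1≤j) ⟩
    c * (c ^ d * l j)     ≡⟨ *-assoc c (c ^ d) (l j) ⟨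
    c ^ suc d * l j       ∎
    where open ≤-Reasoning

  D x : ℕ
  D = c ^ suc s
  x = suc (2 * D)

  RatioBound : ℕ → ℕ → ℕ → Set
  RatioBound p q N = ∀ j → N ≤ j → q * a j ≤ p * l j

  module _ {p q N : ℕ} (bound : RatioBound p q N) where

    scaled-bound : ∀ {u} w → N ≤ u → q * (a u * w) ≤ p * (l u * w)
    scaled-bound {u} w N≤u = begin
      q * (a u * w)  ≡⟨ *-assoc q (a u) w ⟨
      q * a u * w    ≤⟨ *-monoˡ-≤ w (bound u N≤u) ⟩
      p * l u * w    ≡⟨ *-assoc p (l u) w ⟩
      p * (l u * w)  ∎
      where open ≤-Reasoning

    product-bound : ∀ u v → N ≤ u ⊎ N ≤ v → q * (a u * a v) ≤ p * (l u * l v)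
    product-bound u v (inj₁ N≤u) = ≤-trans (scaled-bound (a v) N≤u) (*-monoʳ-≤ p (*-monoʳ-≤ (l u) (a≤l v)))
    product-bound u v (inj₂ N≤v) = subst₂ _≤_ (cong (q *_) (*-comm (a v) (a u))) (cong (p *_) (*-comm (l v) (l u)))
                                          (product-bound v u (inj₁ N≤v))

    bonus-at-s : ∀ {u} → N ≤ u → q * (a u * a s) + p * l u ≤ p * (l u * l s)
    bonus-at-s {u} N≤u = begin
      q * (a u * a s) + p * l u        ≤⟨ +-monoˡ-≤ (p * l u) (scaled-bound (a s) N≤u) ⟩
      p * (l u * a s) + p * l u        ≡⟨ arith p (l u) (a s) ⟩
      p * (l u * suc (a s))            ≤⟨ *-monoʳ-≤ p (*-monoʳ-≤ (l u) a<l) ⟩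
      p * (l u * l s)                  ∎
      where
      open ≤-Reasoning
      arith : ∀ p l a → p * (l * a) + p * l ≡ p * (l * suc a)
      arith = solve-∀

    convolution-gap : ∀ n → N + N ≤ n → s ≤ n → N ≤ n ∸ s → q * (a ⋆ a) n + p * l (n ∸ s) ≤ p * (l ⋆ l) n
    convolution-gap n N+N≤n s≤n N≤n∸s = begin
      q * (a ⋆ a) n + p * l (n ∸ s)                    ≡⟨ cong (_+ p * l (n ∸ s)) (sum≤-*ˡ n q _) ⟨
      (∑[ k ≤ n ] q * (a (n ∸ k) * a k)) + p * l (n ∸ s) ≤⟨ sum≤-bonus n _ s≤n terms (bonus-at-s N≤n∸s) ⟩
      ∑[ k ≤ n ] p * (l (n ∸ k) * l k)                 ≡⟨ sum≤-*ˡ n p _ ⟩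
      p * (l ⋆ l) n                                    ∎
      where
      open ≤-Reasoning
      one-large : ∀ k → k ≤ n → N ≤ n ∸ k ⊎ N ≤ k
      one-large k k≤n with N ≤? k
      ... | yes N≤k = inj₂ N≤k
      ... | no  N≰k = inj₁ (m+n≤o⇒m≤o∸n N (≤-trans (+-monoʳ-≤ N (<⇒≤ (≰⇒> N≰k))) N+N≤n))
      terms : ∀ k → k ≤ n → q * (a (n ∸ k) * a k) ≤ p * (l (n ∸ k) * l k)
      terms k k≤n = product-bound (n ∸ k) k (one-large k k≤n)

    suc-gap : ∀ n → N + N ≤ n → s ≤ n → N ≤ n ∸ s → q * a (suc n) + p * l (n ∸ s) ≤ q + p * l (suc n)
    suc-gap n N+N≤n s≤n N≤n∸s = begin
      q * a (suc n) + p * l (n ∸ s)                   ≤⟨ +-monoˡ-≤ (p * l (n ∸ s)) (*-monoʳ-≤ q (a-suc n)) ⟩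
      q * suc (a n + (a ⋆ a) n) + p * l (n ∸ s)       ≡⟨ arith₁ q (a n) ((a ⋆ a) n) (p * l (n ∸ s)) ⟩
      q + q * a n + (q * (a ⋆ a) n + p * l (n ∸ s))   ≤⟨ +-mono-≤ (+-monoʳ-≤ q (bound n (m+n≤o⇒m≤o N N+N≤n)))
                                                                  (convolution-gap n N+N≤n s≤n N≤n∸s) ⟩
      q + p * l n + p * (l ⋆ l) n                     ≡⟨ arith₂ q p (l n) ((l ⋆ l) n) ⟩
      q + p * (l n + (l ⋆ l) n)                       ≤⟨ +-monoʳ-≤ q (*-monoʳ-≤ p (≤-trans (n≤1+n _) (l-suc n))) ⟩
      q + p * l (suc n)                               ∎
      where
      open ≤-Reasoning
      arith₁ : ∀ q b c d → q * suc (b + c) + d ≡ q + q * b + (q * c + d)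
      arith₁ = solve-∀
      arith₂ : ∀ q p b c → q + p * b + p * c ≡ q + p * (b + c)
      arith₂ = solve-∀

    improve : 1 ≤ p → s < N → RatioBound (x * p) (suc x * q) (suc (s + (N + N + 2 * q)))
    improve 1≤p s<N (suc n) (s≤s threshold) =
      ratio-improve D 1≤p 2q≤l[n∸s] l[1+n]≤D*l[n∸s] (suc-gap n N+N≤n s≤n N≤n∸s)
      where
      s≤n : s ≤ n
      s≤n = m+n≤o⇒m≤o s threshold
      large : N + N + 2 * q ≤ n ∸ s
      large = m+n≤o⇒m≤o∸n (N + N + 2 * q) (subst (_≤ n) (+-comm s _) threshold)
      N+N≤n∸s : N + N ≤ n ∸ s
      N+N≤n∸s = m+n≤o⇒m≤o (N + N) large
      N+N≤n : N + N ≤ n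
      N+N≤n = ≤-trans N+N≤n∸s (m∸n≤m n s)
      N≤n∸s : N ≤ n ∸ s
      N≤n∸s = m+n≤o⇒m≤o N N+N≤n∸s
      2q≤l[n∸s] : 2 * q ≤ l (n ∸ s)
      2q≤l[n∸s] = ≤-trans (m+n≤o⇒n≤o (N + N) large) (n≤l (n ∸ s))
      l[1+n]≤D*l[n∸s] : l (suc n) ≤ D * l (n ∸ s)
      l[1+n]≤D*l[n∸s] = subst (λ i → l (suc i) ≤ D * l (n ∸ s)) (m+[n∸m]≡n s≤n)
        (l-ratio-iter (suc s) (n ∸ s) (≤-trans (s≤s z≤n) (≤-trans s<N N≤n∸s)))

  eventual-bound : ∀ t → ∃[ N ] (s < N × RatioBound (x ^ t) (suc x ^ t) N)
  eventual-bound zero    = suc s , ≤-refl , λ j _ → *-monoʳ-≤ 1 (a≤l j)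
  eventual-bound (suc t) with eventual-bound t
  ... | N , s<N , bound = suc (s + (N + N + 2 * suc x ^ t)) , s≤s (m≤m+n s _) ,
                          improve {x ^ t} {suc x ^ t} bound (m^n>0 x t) s<N

  density : ∀ k → ∃[ N ] (∀ n → N ≤ n → k * a n < l n)
  density k with eventual-bound (k * x)
  ... | N , s<N , bound = N , λ n N≤n → *-cancelˡ-< Q (k * a n) (l n) (begin-strict
    Q * (k * a n)   ≡⟨ arith Q k (a n) ⟩
    k * (Q * a n)   ≤⟨ *-monoʳ-≤ k (bound n N≤n) ⟩
    k * (P * l n)   ≡⟨ *-assoc k P (l n) ⟨
    k * P * l n     <⟨ *-monoˡ-< (l n) {{>-nonZero (l-positive n N≤n)}} (k*x^kx<[1+x]^kx k x (s≤s z≤n)) ⟩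
    Q * l n         ∎)
    where
    open ≤-Reasoning
    P Q : ℕ
    P = x ^ (k * x)
    Q = suc x ^ (k * x)
    l-positive : ∀ n → N ≤ n → 1 ≤ l n
    l-positive n N≤n = ≤-trans (≤-trans (s≤s z≤n) s<N) (≤-trans N≤n (n≤l n))
    arith : ∀ Q k b → Q * (k * b) ≡ k * (Q * b)
    arith = solve-∀

theorem2 : (M : Term) (k : ℕ) → 1 ≤ k →
    ∃[ N ] ((n : ℕ) → N ≤ n → k * A M n < L n)
theorem2 M k _ =
  Density.density L (A M) 9 (size M) (λ n → ≤-reflexive (sym (L-suc n))) (A-suc M) (A≤L M) (A<L M) L-ratio k
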